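{- Let $G$ be a proper circular-arc graph whose complement $\overline{G}$ is not bipartite. Then $G$ has no universal vertex, i.e., no vertex $u$ with $N[u]=V(G)$.
   Context: $N[v]$ denotes the closed neighborhood of $v$ (its neighbors together with $v$). A graph $G$ is a proper circular-arc (PCA) graph if there is a family of arcs of a circle $\mathbb{C}_m=\{1,\dots,m\}$ (arcs being sets of circularly consecutive points) and a bijection $\alpha$ from $V(G)$ to this family such that $u,v$ are adjacent iff $\alpha(u)\cap\alpha(v)\neq\emptyset$, and $\alpha(u)\subseteq\alpha(v)$ holds for no two distinct vertices $u,v$. $\overline{G}$ is the complement graph. -}

module Defs where

open import Data.Nat using (ℕ; suc; _+_; _<_; _≤_; _%_)
open import Data.Fin using (Fin; toℕ)
open import Data.Bool using (Bool)
open import Data.Product using (Σ; ∃; _×_; _,_)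
open import Data.Sum using (_⊎_)
open import Relation.Nullary using (¬_)
open import Relation.Binary.PropositionalEquality using (_≡_; _≢_)

record Graph : Set₁ where
  field
    n       : ℕ
    Adj     : Fin n → Fin n → Set
    sym     : ∀ {u v} → Adj u v → Adj v u
    irrefl  : ∀ {u} → ¬ Adj u u
open Graph public

V : Graph → Set
V G = Fin (n G)

_∈N[_] : {G : Graph} → V G → V G → Set
_∈N[_] {G} v u = (v ≡ u) ⊎ Adj G u v

Universal : (G : Graph) → V G → Set
Universal G u = ∀ (v : V G) → _∈N[_] {G} v u

CoAdj : (G : Graph) → V G → V G → Set
CoAdj G u v = (u ≢ v) × ¬ Adj G u v

complement : Graph → Graph
complement G = record
  { n = n G
  ; Adj = CoAdj G
  ; sym = λ { (u≢v , ¬a) → (λ e → u≢v (Relation.Binary.PropositionalEquality.sym e)) , (λ a → ¬a (Graph.sym G a)) }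
  ; irrefl = λ { (u≢u , _) → u≢u Relation.Binary.PropositionalEquality.refl }
  }

Bipartite : Graph → Set
Bipartite G = Σ (V G → Bool) λ c → ∀ {u v} → Adj G u v → c u ≢ c v

-- Circle C_m with m = suc k points, represented by Fin (suc k).
-- A (nonempty) arc: start point s and length l with 1 ≤ l ≤ m;
-- it is the set {s, s+1, ..., s+l-1} (mod m).
record Arc (k : ℕ) : Set where
  constructor arc
  field
    start : Fin (suc k)
    len   : ℕ
    len≥1 : 1 ≤ len
    len≤m : len ≤ suc k
open Arc public

_∈Arc_ : {k : ℕ} → Fin (suc k) → Arc k → Set
_∈Arc_ {k} p A = Σ ℕ λ i → (i < len A) × (toℕ p ≡ (toℕ (start A) + i) % suc k)

_⊆Arc_ : {k : ℕ} → Arc k → Arc k → Set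
A ⊆Arc B = ∀ p → p ∈Arc A → p ∈Arc B

Intersect : {k : ℕ} → Arc k → Arc k → Set
Intersect A B = ∃ λ p → (p ∈Arc A) × (p ∈Arc B)

record PCAModel (G : Graph) (k : ℕ) : Set where
  field
    α        : V G → Arc k
    adj→int  : ∀ {u v} → u ≢ v → Adj G u v → Intersect (α u) (α v)
    int→adj  : ∀ {u v} → u ≢ v → Intersect (α u) (α v) → Adj G u v
    proper   : ∀ {u v} → u ≢ v → ¬ (α u ⊆Arc α v)

IsPCA : Graph → Set
IsPCA G = Σ ℕ λ k → PCAModel G k

-- Let u be universal and B its arc. Colour every vertex v by whether its arc
-- covers the first point of B. Two vertices of the first colour share that
-- point, so they are adjacent in G. For the second colour we use a fact about
-- arcs: an arc A that meets B but covers neither endpoint of B lies inside B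
-- (walking along A from a common point one can only leave B through one of
-- its endpoints). In a proper model no arc lies inside B, and every arc meets
-- B because u is universal, so every arc missing the first point of B covers
-- its last point; hence two vertices of the second colour are adjacent too.
-- Thus each colour class is a clique of G, i.e. the colouring is proper for
-- the complement.
module Submission where

open import Defs hiding (sym)
open import Data.Product using (∃; _,_)
open import Data.Sum using (_⊎_; inj₁; inj₂)
open import Data.Bool using (Bool)
open import Data.Empty using (⊥-elim)
open import Relation.Nullary using (¬_; Dec; yes; no; does)
open import Data.Nat using (ℕ; zero; suc; _+_; _<_; _%_; _<?_; pred; _≟_; s≤s; z≤n)
open import Data.Nat.Properties
open import Data.Nat.DivMod using (%-distribˡ-+; [m+n]%n≡m%n; m<n⇒m%n≡m; m%n<n)
open import Data.Fin using (Fin; toℕ; fromℕ<)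
open import Data.Fin.Properties using (toℕ<n; toℕ-fromℕ<)
open import Relation.Binary.PropositionalEquality

-- Positions on the circle with m = suc k points are natural numbers read
-- modulo m; an arc covers the positions start, start + 1, …, start + len - 1.
module Circle (k : ℕ) where

  m : ℕ
  m = suc k

  +-cong-% : ∀ c {x y} → x % m ≡ y % m → (c + x) % m ≡ (c + y) % m
  +-cong-% c {x} {y} x≡y = begin
    (c + x) % m             ≡⟨ %-distribˡ-+ c x m ⟩
    (c % m + x % m) % m     ≡⟨ cong (λ z → (c % m + z) % m) x≡y ⟩
    (c % m + y % m) % m     ≡⟨ %-distribˡ-+ c y m ⟨
    (c + y) % m             ∎
    where open ≡-Reasoning

  -- Translation is injective modulo m (translate by k, i.e. by -1).
  suc-cancel-% : ∀ {x y} → suc x % m ≡ suc y % m → x % m ≡ y % m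
  suc-cancel-% {x} {y} sx≡sy = begin
    x % m              ≡⟨ [m+n]%n≡m%n x m ⟨
    (x + m) % m        ≡⟨ cong (_% m) (back x) ⟨
    (k + suc x) % m    ≡⟨ +-cong-% k sx≡sy ⟩
    (k + suc y) % m    ≡⟨ cong (_% m) (back y) ⟩
    (y + m) % m        ≡⟨ [m+n]%n≡m%n y m ⟩
    y % m              ∎
    where
    open ≡-Reasoning
    back : ∀ z → k + suc z ≡ z + m
    back z = trans (+-comm k (suc z)) (sym (+-suc z k))

  record _onArc_ (x : ℕ) (A : Arc k) : Set where
    constructor at
    field
      offset     : ℕ
      offset<len : offset < len A
      position   : x % m ≡ (toℕ (start A) + offset) % m

  first last : Arc k → ℕ
  first A = toℕ (start A)
  last A = toℕ (start A) + pred (len A)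

  endPt : Arc k → Fin m
  endPt A = fromℕ< (m%n<n (last A) m)

  ∈Arc⇒onArc : ∀ {p x A} → toℕ p ≡ x % m → p ∈Arc A → x onArc A
  ∈Arc⇒onArc p≡x (t , t<l , p≡) = at t t<l (trans (sym p≡x) p≡)

  onArc⇒∈Arc : ∀ {p x A} → toℕ p ≡ x % m → x onArc A → p ∈Arc A
  onArc⇒∈Arc p≡x (at t t<l x≡) = t , t<l , trans p≡x x≡

  first-represents : ∀ A → toℕ (start A) ≡ first A % m
  first-represents A = sym (m<n⇒m%n≡m (toℕ<n (start A)))

  last-represents : ∀ A → toℕ (endPt A) ≡ last A % m
  last-represents A = toℕ-fromℕ< (m%n<n (last A) m)

  step-forward : ∀ {x} B → x onArc B → suc x onArc B ⊎ x % m ≡ last B % m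
  step-forward {x} B (at t t<l x≡) with suc t <? len B
  ... | yes st<l = inj₁ (at (suc t) st<l
          (trans (+-cong-% 1 x≡) (cong (_% m) (sym (+-suc (first B) t)))))
  ... | no st≮l = inj₂ (subst (λ z → x % m ≡ (first B + z) % m) t≡last x≡)
    where
    t≡last : t ≡ pred (len B)
    t≡last = cong pred (sym (≤-antisym (≮⇒≥ st≮l) t<l))

  step-backward : ∀ {x} B → suc x onArc B → x onArc B ⊎ suc x % m ≡ first B % m
  step-backward B (at zero _ sx≡) = inj₂ (trans sx≡ (cong (_% m) (+-identityʳ (first B))))
  step-backward B (at (suc t) st<l sx≡) =
    inj₁ (at t (<-trans (n<1+n t) st<l) (suc-cancel-% (trans sx≡ (cong (_% m) (+-suc (first B) t)))))

  walk-forward : ∀ B d {x} → x onArc B → (∀ e → e < d → (x + e) % m ≢ last B % m)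
               → (x + d) onArc B
  walk-forward B zero {x} xB _ = subst (_onArc B) (sym (+-identityʳ x)) xB
  walk-forward B (suc d) {x} xB avoid
    with step-forward B (walk-forward B d xB (λ e e<d → avoid e (m<n⇒m<1+n e<d)))
  ... | inj₁ next = subst (_onArc B) (sym (+-suc x d)) next
  ... | inj₂ atLast = ⊥-elim (avoid d ≤-refl atLast)

  walk-backward : ∀ B d {x} → (x + d) onArc B → (∀ e → e < d → (x + suc e) % m ≢ first B % m)
                → x onArc B
  walk-backward B zero {x} xB _ = subst (_onArc B) (+-identityʳ x) xB
  walk-backward B (suc d) {x} xB avoid
    with step-backward B (subst (_onArc B) (+-suc x d) xB)
  ... | inj₁ prev = walk-backward B d prev (λ e e<d → avoid e (m<n⇒m<1+n e<d))
  ... | inj₂ leftFirst = ⊥-elim (avoid d ≤-refl (trans (cong (_% m) (+-suc x d)) leftFirst))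

  arc-in-arc : ∀ A B → Intersect A B → ¬ start B ∈Arc A → ¬ endPt B ∈Arc A → A ⊆Arc B
  arc-in-arc A B (p , (j , j<l , p≡) , p∈B) ∉first ∉last q (i , i<l , q≡) =
    onArc⇒∈Arc q≡ (spread j<l (∈Arc⇒onArc p≡ p∈B) i<l)
    where
    sA : ℕ
    sA = toℕ (start A)

    not-last : ∀ {i y} → i < len A → y ≡ sA + i → y % m ≢ last B % m
    not-last {i} i<l refl y≡ = ∉last (i , i<l , trans (last-represents B) (sym y≡))

    not-first : ∀ {i y} → i < len A → y ≡ sA + i → y % m ≢ first B % m
    not-first {i} i<l refl y≡ = ∉first (i , i<l , trans (first-represents B) (sym y≡))

    -- From one point of A inside B, walk along A in the appropriate direction.
    spread : ∀ {j} → j < len A → (sA + j) onArc B → ∀ {i} → i < len A → (sA + i) onArc B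
    spread {j} j<l jB {i} i<l with ≤-total j i
    ... | inj₁ j≤i with d , refl ← m≤n⇒∃[o]m+o≡n j≤i =
      subst (_onArc B) (+-assoc sA j d)
        (walk-forward B d jB (λ e e<d →
          not-last (<-trans (+-monoʳ-< j e<d) i<l) (+-assoc sA j e)))
    ... | inj₂ i≤j with d , refl ← m≤n⇒∃[o]m+o≡n i≤j =
      walk-backward B d (subst (_onArc B) (sym (+-assoc sA i d)) jB) (λ e e<d →
        not-first (≤-<-trans (+-monoʳ-≤ i e<d) j<l) (+-assoc sA i (suc e)))

  _∈?_ : ∀ p A → Dec (p ∈Arc A)
  p ∈? A = anyUpTo? (λ t → toℕ p ≟ (first A + t) % m) (len A)

  covers-last : ∀ A B → Intersect A B → ¬ A ⊆Arc B → ¬ start B ∈Arc A → endPt B ∈Arc A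
  covers-last A B A∩B A⊈B ∉first with endPt B ∈? A
  ... | yes ∈last = ∈last
  ... | no ∉last = ⊥-elim (A⊈B (arc-in-arc A B A∩B ∉first ∉last))

  first∈Arc : ∀ A → start A ∈Arc A
  first∈Arc A@(arc s (suc _) _ _) =
    0 , s≤s z≤n , trans (first-represents A) (cong (_% m) (sym (+-identityʳ (toℕ s))))

module UniversalArc {G : Graph} {k : ℕ} (M : PCAModel G k) {u : V G} (univ : Universal G u) where
  open PCAModel M
  open Circle k

  B : Arc k
  B = α u

  covers-last-of-universal : ∀ {v} → ¬ start B ∈Arc α v → endPt B ∈Arc α v
  covers-last-of-universal {v} ∉first = covers-last (α v) B meets (proper v≢u) ∉first
    where
    v≢u : v ≢ u
    v≢u refl = ∉first (first∈Arc B)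

    meets : Intersect (α v) B
    meets with univ v
    ... | inj₁ v≡u = ⊥-elim (v≢u v≡u)
    ... | inj₂ uv with adj→int (λ u≡v → v≢u (sym u≡v)) uv
    ...   | p , p∈B , p∈v = p , p∈v , p∈B

lemma3p2 : (G : Graph) → IsPCA G → ¬ Bipartite (complement G) → ¬ (∃ λ u → Universal G u)
lemma3p2 G (k , M) ¬bip (u , univ) = ¬bip (colour , colour-proper)
  where
  open PCAModel M
  open Circle k
  open UniversalArc M univ

  colour : V G → Bool
  colour v = does (start B ∈? α v)

  -- Equally coloured vertices share a point (the first or the last of B),
  -- so they are adjacent in G.
  colour-proper : ∀ {v w} → CoAdj G v w → colour v ≢ colour w
  colour-proper {v} {w} (v≢w , ¬vw) with start B ∈? α v | start B ∈? α w
  ... | yes ∈v | yes ∈w = λ _ → ¬vw (int→adj v≢w (start B , ∈v , ∈w))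
  ... | no ∉v | no ∉w = λ _ → ¬vw (int→adj v≢w
          (endPt B , covers-last-of-universal ∉v , covers-last-of-universal ∉w))
  ... | yes _ | no _ = λ ()
  ... | no _ | yes _ = λ ()
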